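{- For every integer $\gamma\ge 0$ there exists $g_0$ such that for every $g\ge g_0$ the following holds. Let ${\rm T}$ be a $(3,\gamma)$-hyperelliptic numerical semigroup of genus $g$, let $u_1=u_1({\rm T})$, and suppose that ${\rm T}_{(u_1)_3}=(u_1+3\mathbb{N})\cap[2g]$. Then $u_1\geq g-\gamma+1$. Moreover, if $u_1=g-\gamma+1+\lfloor\frac{(g-\gamma)_3}{2}\rfloor$, then $\#{\rm T}_{(u_1)_3}\ge \#{\rm S}_{(u_1({\rm S}))_3}$ for every $(3,\gamma)$-hyperelliptic numerical semigroup ${\rm S}$ of genus $g$.
   Context: $\mathbb{N}=\{0,1,2,\dots\}$. A numerical semigroup is a subset ${\rm S}\subseteq\mathbb{N}$ containing $0$, closed under addition, with finite complement; its genus is $\#(\mathbb{N}\setminus{\rm S})$. For integers $N,\gamma\ge 0$, ${\rm S}$ is $(N,\gamma)$-hyperelliptic if (1) its first $\gamma$ positive elements $n_1<\dots<n_\gamma$ are multiples of $N$ and $n_\gamma=2\gamma N$, and (2) $(2\gamma+1)N\in{\rm S}$. $(x)_M$ denotes the residue of $x$ modulo $M$ in $\{0,\dots,M-1\}$; $[m]=\{1,\dots,m\}$. For a numerical semigroup ${\rm S}$ of genus $g$: ${\rm S}_i=\{s\in{\rm S}\cap[2g]: (s)_3=i\}$ for $i=0,1,2$, and $u_1({\rm S})=\min\{s\in{\rm S}: (s)_3\neq 0\}$. -}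

module Defs where

open import Data.Nat using (ℕ; zero; suc; _+_; _*_; _∸_; _≤_; _<_; _%_; _/_)
open import Data.Nat.Divisibility using (_∣_)
open import Data.Bool using (Bool; true; false; if_then_else_; not)
open import Data.Product using (Σ; ∃; _×_; ∃-syntax)
open import Relation.Binary.PropositionalEquality using (_≡_; _≢_)
open import Function.Bundles using (_⇔_)

record NumericalSemigroup : Set where
  field
    mem      : ℕ → Bool
    zero∈    : mem 0 ≡ true
    closed   : ∀ a b → mem a ≡ true → mem b ≡ true → mem (a + b) ≡ true
    cofinite : ∃[ B ] (∀ n → B < n → mem n ≡ true)
open NumericalSemigroup public

_∈S_ : ℕ → NumericalSemigroup → Set
n ∈S S = mem S n ≡ true

-- countTo n f = #{ m ∈ [n] = {1,…,n} : f m ≡ true }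
countTo : ℕ → (ℕ → Bool) → ℕ
countTo zero    f = 0
countTo (suc n) f = (if f (suc n) then 1 else 0) + countTo n f

-- genus: number of gaps (gaps are all positive, and all ≤ B for a
-- cofiniteness bound B)
HasGenus : NumericalSemigroup → ℕ → Set
HasGenus S g = ∃[ B ] ((∀ n → B < n → n ∈S S) × countTo B (λ m → not (mem S m)) ≡ g)

IsKthPos : NumericalSemigroup → ℕ → ℕ → Set
IsKthPos S k n = n ∈S S × 0 < n × k ≡ suc (countTo (n ∸ 1) (mem S))

Hyperelliptic : ℕ → ℕ → NumericalSemigroup → Set
Hyperelliptic N γ S =
  (∀ k n → 1 ≤ k → k ≤ γ → IsKthPos S k n → N ∣ n)
  × (1 ≤ γ → IsKthPos S γ (2 * γ * N))
  × ((2 * γ + 1) * N) ∈S S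

IsU1 : NumericalSemigroup → ℕ → Set
IsU1 S u = u ∈S S × u % 3 ≢ 0 × (∀ s → s < u → s ∈S S → s % 3 ≡ 0)

InSi : NumericalSemigroup → ℕ → ℕ → ℕ → Set
InSi S g i s = 1 ≤ s × s ≤ 2 * g × s ∈S S × s % 3 ≡ i

cardSi : NumericalSemigroup → ℕ → ℕ → ℕ
cardSi S g i = countTo (2 * g) (λ s → mem S s Data.Bool.∧ (s % 3 Data.Nat.≡ᵇ i))

InProgression : ℕ → ℕ → ℕ → Set
InProgression u g s = (∃[ k ] s ≡ u + 3 * k) × 1 ≤ s × s ≤ 2 * g

module Submission where

-- For a semigroup S of genus g these give, by reflecting in a gap, that all
-- gaps are < 2g, so [2g] holds exactly g gaps and g elements. For S
-- (3,γ)-hyperelliptic, the same reflection applied to multiples of 3 shows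
-- that every 3i with i > 2γ lies in S, so S has at most γ multiple-of-3 gaps.
--
-- Part (1): if the class of u = u₁(T) in [2g] is all of (u + 3ℕ) ∩ [2g], the
-- gaps of T not divisible by 3 lie below u or strictly between u and 2u, and
-- folding x ↦ 2u - x maps them injectively into [u - 1]; so g ≤ γ + u - 1.
-- Part (2): for any S with v = u₁(S), the class a = #S_{(v)₃} is bounded by
-- counting progressions in windows and translating by v into the third class;
-- combined with the bounds above this gives 9a ≤ 3(g + γ) + 5 + (2g)₃, and a
-- small arithmetic argument shows 3a + u ≤ 2g + 3 for the given u, while T
-- contains u, u + 3, …, u + 3(a - 1), i.e. a ≤ #T_{(u)₃}.

open import Defs
open import Data.Nat using (ℕ; suc; _+_; _∸_; _≤_; _%_; _/_)
open import Data.Product using (∃-syntax; _×_)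
open import Relation.Binary.PropositionalEquality using (_≡_)
open import Function.Bundles using (_⇔_)

open import Data.Nat using (zero; pred; _*_; _<_; z≤n; s≤s; _≡ᵇ_; _≤ᵇ_; _≤?_; _<?_; >-nonZero)
open import Data.Nat.Properties
open import Data.Nat.DivMod
open import Data.Nat.Divisibility using (divides; n∣m⇒m%n≡0)
open import Data.Nat.Tactic.RingSolver using (solve-∀)
open import Data.Bool using (Bool; true; false; not; _∧_; if_then_else_; T)
open import Data.Bool.Properties using (∧-comm; ∧-identityʳ)
open import Data.Product using (_,_; proj₁; proj₂)
open import Data.Sum using (_⊎_; inj₁; inj₂)
open import Data.Empty using (⊥; ⊥-elim)
open import Data.Unit using (tt)
open import Relation.Nullary using (¬_; yes; no)
open import Relation.Binary.PropositionalEquality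
open import Function.Bundles using (Equivalence)
open import Algebra.Properties.CommutativeSemigroup +-commutativeSemigroup using (interchange)

ind : Bool → ℕ
ind b = if b then 1 else 0

infixr 7 _∩_
_∩_ : (ℕ → Bool) → (ℕ → Bool) → ℕ → Bool
(f ∩ g) x = f x ∧ g x

∁_ : (ℕ → Bool) → ℕ → Bool
(∁ f) x = not (f x)

∧-true⁻ : ∀ {a b} → a ∧ b ≡ true → a ≡ true × b ≡ true
∧-true⁻ {true} {true} _ = refl , refl

∧-true⁺ : ∀ {a b} → a ≡ true → b ≡ true → a ∧ b ≡ true
∧-true⁺ refl refl = refl

not-true⁻ : ∀ {a} → not a ≡ true → a ≡ false
not-true⁻ {false} _ = refl

true≢false : ∀ {a} → a ≡ true → a ≡ false → ⊥
true≢false refl ()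

Within : ℕ → (ℕ → Set) → Set
Within n P = ∀ x → 1 ≤ x → x ≤ n → P x

within-pred : ∀ {n P} → Within (suc n) P → Within n P
within-pred h x 1≤x x≤n = h x 1≤x (m≤n⇒m≤1+n x≤n)

within-top : ∀ {n P} → Within (suc n) P → P (suc n)
within-top h = h _ (s≤s z≤n) ≤-refl

countTo-cong : ∀ n {f g} → Within n (λ x → f x ≡ g x) → countTo n f ≡ countTo n g
countTo-cong zero    f≡g = refl
countTo-cong (suc n) f≡g =
  cong₂ _+_ (cong ind (within-top f≡g)) (countTo-cong n (within-pred f≡g))

countTo-all : ∀ n → countTo n (λ _ → true) ≡ n
countTo-all zero    = refl
countTo-all (suc n) = cong suc (countTo-all n)

countTo-split : ∀ n p f → countTo n p ≡ countTo n (p ∩ f) + countTo n (p ∩ ∁ f)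
countTo-split zero    p f = refl
countTo-split (suc n) p f = begin
  ind (p (suc n)) + countTo n p
    ≡⟨ cong₂ _+_ (split-point (p (suc n)) (f (suc n))) (countTo-split n p f) ⟩
  (ind (p (suc n) ∧ f (suc n)) + ind (p (suc n) ∧ not (f (suc n))))
    + (countTo n (p ∩ f) + countTo n (p ∩ ∁ f))
    ≡⟨ interchange (ind (p (suc n) ∧ f (suc n))) (ind (p (suc n) ∧ not (f (suc n))))
                   (countTo n (p ∩ f)) (countTo n (p ∩ ∁ f)) ⟩
  countTo (suc n) (p ∩ f) + countTo (suc n) (p ∩ ∁ f) ∎
  where
  open ≡-Reasoning
  split-point : ∀ b a → ind b ≡ ind (b ∧ a) + ind (b ∧ not a)
  split-point false _     = refl
  split-point true  true  = refl
  split-point true  false = refl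

countTo-∩-comm : ∀ n f g → countTo n (f ∩ g) ≡ countTo n (g ∩ f)
countTo-∩-comm n f g = countTo-cong n (λ x _ _ → ∧-comm (f x) (g x))

InjectiveOn : ℕ → (ℕ → Bool) → (ℕ → ℕ) → Set
InjectiveOn n f h = ∀ x y → 1 ≤ x → x ≤ n → 1 ≤ y → y ≤ n →
  f x ≡ true → f y ≡ true → h x ≡ h y → x ≡ y

MapsInto : ℕ → (ℕ → Bool) → ℕ → (ℕ → Bool) → (ℕ → ℕ) → Set
MapsInto n f m g h = Within n (λ x → f x ≡ true → 1 ≤ h x × h x ≤ m × g (h x) ≡ true)

injectiveOn-pred : ∀ {n f h} → InjectiveOn (suc n) f h → InjectiveOn n f h
injectiveOn-pred inj x y 1≤x x≤n 1≤y y≤n = inj x y 1≤x (m≤n⇒m≤1+n x≤n) 1≤y (m≤n⇒m≤1+n y≤n)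

≡ᵇ-refl : ∀ x → (x ≡ᵇ x) ≡ true
≡ᵇ-refl zero    = refl
≡ᵇ-refl (suc x) = ≡ᵇ-refl x

≢⇒≡ᵇ-false : ∀ x y → x ≢ y → (x ≡ᵇ y) ≡ false
≢⇒≡ᵇ-false x y x≢y with x ≡ᵇ y in eq
... | true  = ⊥-elim (x≢y (≡ᵇ⇒≡ x y (subst T (sym eq) tt)))
... | false = refl

without : (ℕ → Bool) → ℕ → ℕ → Bool
without g y = g ∩ (λ z → not (z ≡ᵇ y))

countTo-without : ∀ m g y → 1 ≤ y → y ≤ m → g y ≡ true →
  countTo m g ≡ suc (countTo m (without g y))
countTo-without zero    g y 1≤y y≤0 gy = ⊥-elim (<-irrefl refl (≤-trans 1≤y y≤0))
countTo-without (suc m) g y 1≤y y≤1+m gy with y ≟ suc m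
... | yes refl rewrite gy | ≡ᵇ-refl (suc m) =
  cong suc (countTo-cong m (λ x _ x≤m → sym (keep x (λ x≡ → <-irrefl x≡ (s≤s x≤m)))))
  where
  keep : ∀ x → x ≢ suc m → without g (suc m) x ≡ g x
  keep x x≢ rewrite ≢⇒≡ᵇ-false x (suc m) x≢ = ∧-identityʳ (g x)
... | no y≢ rewrite ≢⇒≡ᵇ-false (suc m) y (≢-sym y≢) | ∧-identityʳ (g (suc m)) =
  trans (cong (ind (g (suc m)) +_) (countTo-without m g y 1≤y (≤-pred (≤∧≢⇒< y≤1+m y≢)) gy))
        (+-suc (ind (g (suc m))) _)

countTo-inj : ∀ n m f g h → InjectiveOn n f h → MapsInto n f m g h →
  countTo n f ≤ countTo m g
countTo-inj zero    m f g h inj into = z≤n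
countTo-inj (suc n) m f g h inj into with f (suc n) in fn
... | false = countTo-inj n m f g h (injectiveOn-pred inj) (within-pred into)
... | true with within-top into fn
...   | (1≤h , h≤m , gh) rewrite countTo-without m g (h (suc n)) 1≤h h≤m gh =
  s≤s (countTo-inj n m f (without g (h (suc n))) h (injectiveOn-pred inj) into′)
  where
  into′ : MapsInto n f m (without g (h (suc n))) h
  into′ x 1≤x x≤n fx with within-pred into x 1≤x x≤n fx
  ... | (1≤hx , hx≤m , ghx) = 1≤hx , hx≤m , (begin
    g (h x) ∧ not (h x ≡ᵇ h (suc n)) ≡⟨ cong₂ _∧_ ghx (cong not (≢⇒≡ᵇ-false _ _ hx≢)) ⟩
    true ∎)
    where
    open ≡-Reasoning
    hx≢ : h x ≢ h (suc n)
    hx≢ hx≡ = <-irrefl (inj x (suc n) 1≤x (m≤n⇒m≤1+n x≤n) (s≤s z≤n) ≤-refl fx fn hx≡) (s≤s x≤n)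

countTo-mono : ∀ n f g → Within n (λ x → f x ≡ true → g x ≡ true) → countTo n f ≤ countTo n g
countTo-mono n f g f⇒g =
  countTo-inj n n f g (λ x → x) (λ _ _ _ _ _ _ _ _ eq → eq)
    (λ x 1≤x x≤n fx → 1≤x , x≤n , f⇒g x 1≤x x≤n fx)

countTo-support : ∀ n m f → Within n (λ x → f x ≡ true → x ≤ m) → countTo n f ≤ countTo m f
countTo-support n m f bound =
  countTo-inj n m f f (λ x → x) (λ _ _ _ _ _ _ _ _ eq → eq)
    (λ x 1≤x x≤n fx → 1≤x , bound x 1≤x x≤n fx , fx)

residue : ℕ → ℕ → Bool
residue i x = x % 3 ≡ᵇ i

residue⇒ : ∀ {i} x → residue i x ≡ true → x % 3 ≡ i
residue⇒ {i} x e = ≡ᵇ⇒≡ (x % 3) i (subst T (sym e) tt)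

⇒residue : ∀ {i} x → x % 3 ≡ i → residue i x ≡ true
⇒residue {i} x refl = ≡ᵇ-refl i

≢⇒residue-false : ∀ {i} x → x % 3 ≢ i → residue i x ≡ false
≢⇒residue-false {i} x = ≢⇒≡ᵇ-false (x % 3) i

residue-cases : ∀ x → x % 3 ≡ 0 ⊎ x % 3 ≡ 1 ⊎ x % 3 ≡ 2
residue-cases x with x % 3 | m%n<n x 3
... | 0 | _ = inj₁ refl
... | 1 | _ = inj₂ (inj₁ refl)
... | 2 | _ = inj₂ (inj₂ refl)
... | suc (suc (suc _)) | s≤s (s≤s (s≤s ()))

euclid : ∀ x → x ≡ 3 * (x / 3) + x % 3
euclid x = trans (m≡m%n+[m/n]*n x 3) (trans (+-comm (x % 3) _) (cong (_+ x % 3) (*-comm (x / 3) 3)))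

progression-residue : ∀ c k → (c + 3 * k) % 3 ≡ c % 3
progression-residue c k = trans (cong (λ z → (c + z) % 3) (*-comm 3 k)) ([m+kn]%n≡m%n c k 3)

multiple-residue : ∀ k → (3 * k) % 3 ≡ 0
multiple-residue k = trans (cong (_% 3) (*-comm 3 k)) (m*n%n≡0 k 3)

residue0⇒multiple : ∀ x → x % 3 ≡ 0 → x ≡ 3 * (x / 3)
residue0⇒multiple x x%3≡0 = trans (euclid x) (trans (cong (3 * (x / 3) +_) x%3≡0) (+-identityʳ _))

same-residue⇒progression : ∀ x y → x % 3 ≡ y % 3 → y ≤ x → ∃[ k ] x ≡ y + 3 * k
same-residue⇒progression x y same y≤x = x / 3 ∸ y / 3 , (begin
  x                                     ≡⟨ euclid x ⟩
  3 * (x / 3) + x % 3                   ≡⟨ cong₂ (λ a b → 3 * a + b) (sym (m+[n∸m]≡n y/3≤x/3)) same ⟩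
  3 * (y / 3 + (x / 3 ∸ y / 3)) + y % 3 ≡⟨ rearrange (y / 3) (x / 3 ∸ y / 3) (y % 3) ⟩
  (3 * (y / 3) + y % 3) + 3 * (x / 3 ∸ y / 3) ≡⟨ cong (_+ 3 * (x / 3 ∸ y / 3)) (sym (euclid y)) ⟩
  y + 3 * (x / 3 ∸ y / 3) ∎)
  where
  open ≡-Reasoning
  y/3≤x/3 : y / 3 ≤ x / 3
  y/3≤x/3 = /-monoˡ-≤ 3 y≤x
  rearrange : ∀ a b c → 3 * (a + b) + c ≡ (3 * a + c) + 3 * b
  rearrange = solve-∀

doubled : ∀ u → (u + u) % 3 ≡ (u % 3 + u % 3) % 3
doubled u = %-distribˡ-+ u u 3

doubled-residue : ∀ u → u % 3 ≢ 0 → (u + u) % 3 ≢ 0 × (u + u) % 3 ≢ u % 3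
doubled-residue u u≢0 rewrite doubled u with residue-cases u
... | inj₁ u≡0 = ⊥-elim (u≢0 u≡0)
... | inj₂ (inj₁ u≡1) rewrite u≡1 = (λ ()) , (λ ())
... | inj₂ (inj₂ u≡2) rewrite u≡2 = (λ ()) , (λ ())

third-residue : ∀ u x → u % 3 ≢ 0 → x % 3 ≢ 0 → x % 3 ≢ u % 3 → x % 3 ≡ (u + u) % 3
third-residue u x u≢0 x≢0 x≢u rewrite doubled u with residue-cases u | residue-cases x
... | inj₁ u≡0 | _ = ⊥-elim (u≢0 u≡0)
... | _ | inj₁ x≡0 = ⊥-elim (x≢0 x≡0)
... | inj₂ (inj₁ u≡1) | inj₂ (inj₁ x≡1) = ⊥-elim (x≢u (trans x≡1 (sym u≡1)))
... | inj₂ (inj₁ u≡1) | inj₂ (inj₂ x≡2) rewrite u≡1 = x≡2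
... | inj₂ (inj₂ u≡2) | inj₂ (inj₁ x≡1) rewrite u≡2 = x≡1
... | inj₂ (inj₂ u≡2) | inj₂ (inj₂ x≡2) = ⊥-elim (x≢u (trans x≡2 (sym u≡2)))

sum-residue : ∀ s v → s % 3 ≡ v % 3 → (s + v) % 3 ≡ (v + v) % 3
sum-residue s v same = trans (%-distribˡ-+ s v 3)
  (trans (cong (λ z → (z + v % 3) % 3) same) (sym (%-distribˡ-+ v v 3)))

-- [n] contains exactly ⌊n/3⌋ multiples of 3: x ↦ x/3 and j ↦ 3j are
-- mutually inverse injections between them and [⌊n/3⌋].
multiples-count : ∀ n → countTo n (residue 0) ≡ n / 3
multiples-count n = ≤-antisym
  (subst (countTo n (residue 0) ≤_) (countTo-all (n / 3))
    (countTo-inj n (n / 3) (residue 0) (λ _ → true) (_/ 3) quotient-inj quotient-into))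
  (subst (_≤ countTo n (residue 0)) (countTo-all (n / 3))
    (countTo-inj (n / 3) n (λ _ → true) (residue 0) (3 *_) triple-inj triple-into))
  where
  quotient-inj : InjectiveOn n (residue 0) (_/ 3)
  quotient-inj x y _ _ _ _ x≡0 y≡0 eq = begin
    x           ≡⟨ residue0⇒multiple x (residue⇒ x x≡0) ⟩
    3 * (x / 3) ≡⟨ cong (3 *_) eq ⟩
    3 * (y / 3) ≡⟨ sym (residue0⇒multiple y (residue⇒ y y≡0)) ⟩
    y ∎
    where open ≡-Reasoning
  quotient-into : MapsInto n (residue 0) (n / 3) (λ _ → true) (_/ 3)
  quotient-into x 1≤x x≤n x≡0 = n≢0⇒n>0 x/3≢0 , /-monoˡ-≤ 3 x≤n , refl
    where
    x/3≢0 : x / 3 ≢ 0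
    x/3≢0 x/3≡0 = <-irrefl (sym (trans (residue0⇒multiple x (residue⇒ x x≡0)) (cong (3 *_) x/3≡0))) 1≤x
  triple-inj : InjectiveOn (n / 3) (λ _ → true) (3 *_)
  triple-inj x y _ _ _ _ _ _ eq = *-cancelˡ-≡ x y 3 eq
  triple-into : MapsInto (n / 3) (λ _ → true) n (residue 0) (3 *_)
  triple-into j 1≤j j≤n/3 _ =
    ≤-trans 1≤j (m≤m+n j _) ,
    ≤-trans (*-monoʳ-≤ 3 j≤n/3) (subst (_≤ n) (*-comm (n / 3) 3) (m/n*n≤m n 3)) ,
    ⇒residue (3 * j) (multiple-residue j)

multiples-count-exact : ∀ q ρ → ρ < 3 → countTo (3 * q + ρ) (residue 0) ≡ q
multiples-count-exact q ρ ρ<3 = begin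
  countTo (3 * q + ρ) (residue 0) ≡⟨ multiples-count (3 * q + ρ) ⟩
  (3 * q + ρ) / 3                 ≡⟨ +-distrib-/-∣ˡ ρ (divides q (*-comm 3 q)) ⟩
  (3 * q) / 3 + ρ / 3             ≡⟨ cong₂ _+_ (trans (cong (_/ 3) (*-comm 3 q)) (m*n/n≡m q 3)) (m<n⇒m/n≡0 ρ<3) ⟩
  q + 0                           ≡⟨ +-identityʳ q ⟩
  q ∎
  where open ≡-Reasoning

residue-false : ∀ {i j} x → x % 3 ≡ i → i ≢ j → residue j x ≡ false
residue-false x x≡i i≢j = ≢⇒residue-false x (λ x≡j → i≢j (trans (sym x≡i) x≡j))

gaps : NumericalSemigroup → ℕ → Bool
gaps S = ∁ (mem S)

-- Reflection in a gap f = n + 1: if x ∈ S then f - x is a gap, so among the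
-- points of [n] satisfying a reflection-invariant P, at least half are gaps.
reflection : ∀ S P n → mem S (suc n) ≡ false →
  Within n (λ x → P x ≡ true → P (suc n ∸ x) ≡ true) →
  countTo n P ≤ countTo n (P ∩ gaps S) + countTo n (P ∩ gaps S)
reflection S P n f-gap P-symmetric = begin
  countTo n P                                     ≡⟨ countTo-split n P (mem S) ⟩
  countTo n (P ∩ mem S) + countTo n (P ∩ gaps S)  ≤⟨ +-monoˡ-≤ _ elements≤gaps ⟩
  countTo n (P ∩ gaps S) + countTo n (P ∩ gaps S) ∎
  where
  open ≤-Reasoning
  elements≤gaps : countTo n (P ∩ mem S) ≤ countTo n (P ∩ gaps S)
  elements≤gaps = countTo-inj n n (P ∩ mem S) (P ∩ gaps S) (suc n ∸_)
    (λ x y _ x≤n _ y≤n _ _ eq → ∸-cancelˡ-≡ (m≤n⇒m≤1+n x≤n) (m≤n⇒m≤1+n y≤n) eq)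
    into
    where
    into : MapsInto n (P ∩ mem S) n (P ∩ gaps S) (suc n ∸_)
    into x 1≤x x≤n Px∧x∈S with ∧-true⁻ Px∧x∈S
    ... | (Px , x∈S) = m<n⇒0<n∸m (s≤s x≤n) , ∸-monoʳ-≤ (suc n) 1≤x ,
                        ∧-true⁺ (P-symmetric x 1≤x x≤n Px) (cong not mirror-gap)
      where
      mirror-gap : mem S (suc n ∸ x) ≡ false
      mirror-gap with mem S (suc n ∸ x) in e
      ... | false = refl
      ... | true  = ⊥-elim (true≢false
              (subst (_≡ true) (cong (mem S) (m+[n∸m]≡n (m≤n⇒m≤1+n x≤n))) (closed S x _ x∈S e)) f-gap)

gap≤bound : ∀ S B → (∀ n → B < n → n ∈S S) → ∀ x → mem S x ≡ false → x ≤ B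
gap≤bound S B above-B x x-gap with x ≤? B
... | yes x≤B = x≤B
... | no  x≰B = ⊥-elim (true≢false (above-B x (≰⇒> x≰B)) x-gap)

-- Every gap of a semigroup of genus g is smaller than 2g: reflecting [f-1]
-- in a gap f shows f - 1 ≤ 2(g - 1).
gap<2g : ∀ S g → HasGenus S g → ∀ x → mem S x ≡ false → x < 2 * g
gap<2g S g _ zero 0-gap = ⊥-elim (true≢false (zero∈ S) 0-gap)
gap<2g S g (B , above-B , #gaps) (suc n) f-gap = begin-strict
  suc n                   ≤⟨ s≤s (subst (_≤ G + G) (countTo-all n) (reflection S (λ _ → true) n f-gap (λ _ _ _ _ → refl))) ⟩
  suc (G + G)             <⟨ s≤s (≤-reflexive (sym (+-suc G G))) ⟩
  suc G + suc G           ≤⟨ +-mono-≤ G<g G<g ⟩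
  g + g                   ≡⟨ cong (g +_) (sym (+-identityʳ g)) ⟩
  2 * g ∎
  where
  open ≤-Reasoning
  G = countTo n (gaps S)
  G<g : suc G ≤ g
  G<g = begin
    suc G                        ≡⟨ cong (λ b → ind (not b) + G) (sym f-gap) ⟩
    countTo (suc n) (gaps S)     ≤⟨ countTo-support (suc n) B (gaps S) (λ x _ _ gx → gap≤bound S B above-B x (not-true⁻ gx)) ⟩
    countTo B (gaps S)           ≡⟨ #gaps ⟩
    g ∎

mem-from-2g : ∀ S g → HasGenus S g → ∀ x → 2 * g ≤ x → mem S x ≡ true
mem-from-2g S g H x 2g≤x with mem S x in e
... | true  = refl
... | false = ⊥-elim (<-irrefl refl (≤-trans (gap<2g S g H x e) 2g≤x))

genus-count : ∀ S g → HasGenus S g → countTo (2 * g) (gaps S) ≡ g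
genus-count S g H@(B , above-B , #gaps) = ≤-antisym
  (subst (countTo (2 * g) (gaps S) ≤_) #gaps
    (countTo-support (2 * g) B (gaps S) (λ x _ _ gx → gap≤bound S B above-B x (not-true⁻ gx))))
  (subst (_≤ countTo (2 * g) (gaps S)) #gaps
    (countTo-support B (2 * g) (gaps S) (λ x _ _ gx → <⇒≤ (gap<2g S g H x (not-true⁻ gx)))))

element-count : ∀ S g → HasGenus S g → countTo (2 * g) (mem S) ≡ g
element-count S g H = +-cancelʳ-≡ g _ g (begin
  countTo (2 * g) (mem S) + g                          ≡⟨ cong (countTo (2 * g) (mem S) +_) (sym (genus-count S g H)) ⟩
  countTo (2 * g) (mem S) + countTo (2 * g) (gaps S)   ≡⟨ sym (countTo-split (2 * g) (λ _ → true) (mem S)) ⟩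
  countTo (2 * g) (λ _ → true)                         ≡⟨ countTo-all (2 * g) ⟩
  g + (g + 0)                                          ≡⟨ cong (g +_) (+-identityʳ g) ⟩
  g + g ∎)
  where open ≡-Reasoning

u₁-positive : ∀ S u → IsU1 S u → 1 ≤ u
u₁-positive S u (_ , u≢0 , _) = n≢0⇒n>0 (λ u≡0 → u≢0 (cong (_% 3) u≡0))

class-of-u₁ : ∀ S u → IsU1 S u → ∀ s → mem S s ≡ true → s % 3 ≡ u % 3 → ∃[ k ] s ≡ u + 3 * k
class-of-u₁ S u (_ , u≢0 , below-u) s s∈S same with u ≤? s
... | yes u≤s = same-residue⇒progression s u same u≤s
... | no  u≰s = ⊥-elim (u≢0 (trans (sym same) (below-u s (≰⇒> u≰s) s∈S)))

triple-cancel : ∀ x y → 3 * x ≤ 3 * y + 2 → x ≤ y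
triple-cancel x y 3x≤3y+2 = ≤-pred (*-cancelˡ-< 3 x (suc y) (begin-strict
  3 * x     ≤⟨ 3x≤3y+2 ⟩
  3 * y + 2 <⟨ +-monoʳ-< (3 * y) (s≤s (s≤s (s≤s z≤n))) ⟩
  3 * y + 3 ≡⟨ trans (+-comm (3 * y) 3) (sym (*-suc 3 y)) ⟩
  3 * suc y ∎))
  where open ≤-Reasoning

multipleGaps : NumericalSemigroup → ℕ → Bool
multipleGaps S = residue 0 ∩ gaps S

-- If 3(K+1) is a gap, reflecting in it shows that at least half of the K
-- multiples of 3 below it are gaps.
gap-multiple-bound : ∀ S K → mem S (3 * suc K) ≡ false →
  K ≤ countTo (3 * K + 2) (multipleGaps S) + countTo (3 * K + 2) (multipleGaps S)
gap-multiple-bound S K gap =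
  subst (_≤ G + G) (multiples-count-exact K 2 (s≤s (s≤s (s≤s z≤n))))
    (reflection S (residue 0) (3 * K + 2) (subst (λ z → mem S z ≡ false) (sym top) gap) symmetric)
  where
  G = countTo (3 * K + 2) (multipleGaps S)
  top : suc (3 * K + 2) ≡ 3 * suc K
  top = next-multiple K
    where
    next-multiple : ∀ K → suc (3 * K + 2) ≡ 3 * suc K
    next-multiple = solve-∀
  symmetric : Within (3 * K + 2) (λ x → residue 0 x ≡ true → residue 0 (suc (3 * K + 2) ∸ x) ≡ true)
  symmetric x _ _ x≡0 = ⇒residue (suc (3 * K + 2) ∸ x) (begin
    (suc (3 * K + 2) ∸ x) % 3         ≡⟨ cong₂ (λ a b → (a ∸ b) % 3) top (residue0⇒multiple x (residue⇒ x x≡0)) ⟩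
    (3 * suc K ∸ 3 * (x / 3)) % 3     ≡⟨ cong (_% 3) (sym (*-distribˡ-∸ 3 (suc K) (x / 3))) ⟩
    (3 * (suc K ∸ x / 3)) % 3         ≡⟨ multiple-residue (suc K ∸ x / 3) ⟩
    0 ∎)
    where open ≡-Reasoning

-- 6γ as written in the definition of (3,γ)-hyperellipticity.
six-γ : ∀ γ → 2 * γ * 3 ≡ 3 * (2 * γ)
six-γ γ = *-comm (2 * γ) 3

-- In a (3,γ)-hyperelliptic semigroup, [6γ] contains exactly γ elements, all
-- multiples of 3, so at most 2γ - γ = γ of its 2γ multiples of 3 are gaps.
multipleGaps-below-6γ : ∀ S γ → Hyperelliptic 3 γ S → countTo (2 * γ * 3) (multipleGaps S) ≤ γ
multipleGaps-below-6γ S zero    _ = z≤n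
multipleGaps-below-6γ S (suc γ′) (kth-multiple , kth-6γ , _) = +-cancelˡ-≤ γ _ _ (begin
  γ + G                                              ≤⟨ +-monoˡ-≤ G γ≤elements ⟩
  countTo N (residue 0 ∩ mem S) + G                  ≡⟨ sym (countTo-split N (residue 0) (mem S)) ⟩
  countTo N (residue 0)                              ≡⟨ cong (λ z → countTo z (residue 0)) (trans (six-γ γ) (sym (+-identityʳ _))) ⟩
  countTo (3 * (2 * γ) + 0) (residue 0)              ≡⟨ multiples-count-exact (2 * γ) 0 (s≤s z≤n) ⟩
  2 * γ                                              ≡⟨ cong (γ +_) (+-identityʳ γ) ⟩
  γ + γ ∎)
  where
  open ≤-Reasoning
  γ = suc γ′
  N = 2 * γ * 3
  G = countTo N (multipleGaps S)
  N∈S : mem S N ≡ true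
  N∈S = proj₁ (kth-6γ (s≤s z≤n))
  γ≡ : γ ≡ suc (countTo (N ∸ 1) (mem S))
  γ≡ = proj₂ (proj₂ (kth-6γ (s≤s z≤n)))
  elements-are-multiples : Within N (λ x → mem S x ≡ true → (residue 0 ∩ mem S) x ≡ true)
  elements-are-multiples (suc x) _ 1+x≤N x∈S with m≤n⇒m<n∨m≡n 1+x≤N
  ... | inj₂ refl = ∧-true⁺ (⇒residue N (trans (cong (_% 3) (six-γ γ)) (multiple-residue (2 * γ)))) x∈S
  ... | inj₁ 1+x<N = ∧-true⁺ (⇒residue (suc x) (n∣m⇒m%n≡0 (suc x) 3 3∣x)) x∈S
    where
    k = suc (countTo x (mem S))
    k≤γ : k ≤ γ
    k≤γ = begin
      suc (countTo x (mem S))   ≡⟨ cong (λ b → ind b + countTo x (mem S)) (sym x∈S) ⟩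
      countTo (suc x) (mem S)   ≤⟨ countTo-support (suc x) (N ∸ 1) (mem S) (λ y _ y≤x _ → ≤-trans y≤x (≤-pred 1+x<N)) ⟩
      countTo (N ∸ 1) (mem S)   ≡⟨ sym (suc-injective γ≡) ⟩
      γ′                        ≤⟨ n≤1+n γ′ ⟩
      γ ∎
    3∣x = kth-multiple k (suc x) (s≤s z≤n) k≤γ (x∈S , s≤s z≤n , refl)
  γ≤elements : γ ≤ countTo N (residue 0 ∩ mem S)
  γ≤elements = begin
    γ                                ≡⟨ γ≡ ⟩
    suc (countTo (N ∸ 1) (mem S))    ≡⟨ cong (λ b → ind b + countTo (N ∸ 1) (mem S)) (sym N∈S) ⟩
    countTo N (mem S)                ≤⟨ countTo-mono N (mem S) (residue 0 ∩ mem S) elements-are-multiples ⟩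
    countTo N (residue 0 ∩ mem S) ∎

multipleGap≤6γ : ∀ S γ x → multipleGaps S x ≡ true →
  (∀ j → 3 * (2 * γ + 1 + j) ≤ x → mem S (3 * (2 * γ + 1 + j)) ≡ true) → x ≤ 2 * γ * 3
multipleGap≤6γ S γ x x-mgap large∈S with ∧-true⁻ x-mgap
... | (x≡0 , x-gap) with x / 3 ≤? 2 * γ
...   | yes q≤2γ = begin
  x             ≡⟨ residue0⇒multiple x (residue⇒ x x≡0) ⟩
  3 * (x / 3)   ≤⟨ *-monoʳ-≤ 3 q≤2γ ⟩
  3 * (2 * γ)   ≡⟨ sym (six-γ γ) ⟩
  2 * γ * 3 ∎
  where open ≤-Reasoning
...   | no  q≰2γ = ⊥-elim (true≢false (subst (λ z → mem S z ≡ true) x≡ (large∈S j (≤-reflexive x≡))) (not-true⁻ x-gap))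
  where
  2γ<q : 2 * γ + 1 ≤ x / 3
  2γ<q = subst (_≤ x / 3) (+-comm 1 (2 * γ)) (≰⇒> q≰2γ)
  j = x / 3 ∸ (2 * γ + 1)
  x≡ : 3 * (2 * γ + 1 + j) ≡ x
  x≡ = trans (cong (3 *_) (m+[n∸m]≡n 2γ<q)) (sym (residue0⇒multiple x (residue⇒ x x≡0)))

-- Every 3i with i > 2γ lies in S. By induction on i: if 3(K+1) were the first
-- gap among them, every multiple-of-3 gap below it would lie in [6γ], so by
-- gap-multiple-bound K ≤ 2γ, contradicting K ≥ 2γ + 1.
large-multiples-in-S : ∀ S γ → Hyperelliptic 3 γ S → ∀ j → mem S (3 * (2 * γ + 1 + j)) ≡ true
large-multiples-in-S S γ H@(_ , _ , top∈S) j = up-to j j ≤-refl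
  where
  up-to : ∀ d j → j ≤ d → mem S (3 * (2 * γ + 1 + j)) ≡ true
  up-to zero    zero     _ = subst (λ z → mem S z ≡ true) first top∈S
    where
    first : (2 * γ + 1) * 3 ≡ 3 * (2 * γ + 1 + 0)
    first = trans (*-comm (2 * γ + 1) 3) (cong (3 *_) (sym (+-identityʳ (2 * γ + 1))))
  up-to (suc d) j j≤1+d with m≤n⇒m<n∨m≡n j≤1+d
  ... | inj₁ j<1+d = up-to d j (≤-pred j<1+d)
  ... | inj₂ refl with mem S (3 * (2 * γ + 1 + suc d)) in next
  ...   | true  = refl
  ...   | false = ⊥-elim (<-irrefl refl (begin-strict
    2 * γ         <⟨ <-≤-trans (m<m+n (2 * γ) (s≤s z≤n)) (m≤m+n (2 * γ + 1) d) ⟩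
    K             ≤⟨ gap-multiple-bound S K gap ⟩
    G + G         ≤⟨ +-mono-≤ G≤γ G≤γ ⟩
    γ + γ         ≡⟨ cong (γ +_) (sym (+-identityʳ γ)) ⟩
    2 * γ ∎))
    where
    open ≤-Reasoning
    K = 2 * γ + 1 + d
    G = countTo (3 * K + 2) (multipleGaps S)
    gap : mem S (3 * suc K) ≡ false
    gap = subst (λ z → mem S (3 * z) ≡ false) (+-suc (2 * γ + 1) d) next
    G≤γ : G ≤ γ
    G≤γ = ≤-trans
      (countTo-support (3 * K + 2) (2 * γ * 3) (multipleGaps S)
        (λ x _ x≤3K+2 x-mgap → multipleGap≤6γ S γ x x-mgap
          (λ i 3i≤x → up-to d i (+-cancelˡ-≤ (2 * γ + 1) i d
            (triple-cancel (2 * γ + 1 + i) K (≤-trans 3i≤x x≤3K+2))))))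
      (multipleGaps-below-6γ S γ H)

-- Hence all multiple-of-3 gaps lie in [6γ]: there are at most γ of them.
multipleGaps-bound : ∀ S γ → Hyperelliptic 3 γ S → ∀ N → countTo N (multipleGaps S) ≤ γ
multipleGaps-bound S γ H N = ≤-trans
  (countTo-support N (2 * γ * 3) (multipleGaps S)
    (λ x _ _ x-mgap → multipleGap≤6γ S γ x x-mgap (λ j _ → large-multiples-in-S S γ H j)))
  (multipleGaps-below-6γ S γ H)

progression-depth : ∀ h c k → (h ∸ (c + 3 * k)) / 3 ≡ (h ∸ c) / 3 ∸ k
progression-depth h c k = begin
  (h ∸ (c + 3 * k)) / 3  ≡⟨ cong (_/ 3) (sym (∸-+-assoc h c (3 * k))) ⟩
  (h ∸ c ∸ 3 * k) / 3    ≡⟨ cong (λ z → (h ∸ c ∸ z) / 3) (*-comm 3 k) ⟩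
  (h ∸ c ∸ k * 3) / 3    ≡⟨ [m∸n*o]/o≡m/o∸n (h ∸ c) k 3 ⟩
  (h ∸ c) / 3 ∸ k ∎
  where open ≡-Reasoning

progression-index≤ : ∀ h c k → c + 3 * k ≤ h → k ≤ (h ∸ c) / 3
progression-index≤ h c k le = begin
  k                ≡⟨ sym (m*n/n≡m k 3) ⟩
  (k * 3) / 3      ≤⟨ /-monoˡ-≤ 3 (m+n≤o⇒m≤o∸n (k * 3) (subst (_≤ h) reorder le)) ⟩
  (h ∸ c) / 3 ∎
  where
  open ≤-Reasoning
  reorder : c + 3 * k ≡ k * 3 + c
  reorder = trans (+-comm c (3 * k)) (cong (_+ c) (*-comm 3 k))

-- A window (lo, hi] of length L contains at most ⌈L/3⌉ points of a
-- progression c + 3ℕ; counting them by their depth ⌊(hi - x)/3⌋ below hi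
-- gives the bound in the form 3·#points ≤ 3 + (L - 1).
progression-window : ∀ n lo hi c (f : ℕ → Bool) →
  Within n (λ x → f x ≡ true → lo < x × x ≤ hi × ∃[ k ] x ≡ c + 3 * k) →
  3 * countTo n f ≤ 3 + (hi ∸ suc lo)
progression-window n lo hi c f window = begin
  3 * countTo n f   ≤⟨ *-monoʳ-≤ 3 count≤ ⟩
  3 * suc (L / 3)   ≡⟨ *-suc 3 (L / 3) ⟩
  3 + 3 * (L / 3)   ≤⟨ +-monoʳ-≤ 3 (subst (_≤ L) (*-comm (L / 3) 3) (m/n*n≤m L 3)) ⟩
  3 + L ∎
  where
  open ≤-Reasoning
  L = hi ∸ suc lo
  depth : ℕ → ℕ
  depth x = suc ((hi ∸ x) / 3)
  depth-inj : InjectiveOn n f depth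
  depth-inj x y 1≤x x≤n 1≤y y≤n fx fy eq with window x 1≤x x≤n fx | window y 1≤y y≤n fy
  ... | (_ , x≤hi , k , refl) | (_ , y≤hi , k′ , refl) =
    cong (λ z → c + 3 * z) (∸-cancelˡ-≡ (progression-index≤ hi c k x≤hi) (progression-index≤ hi c k′ y≤hi)
      (trans (sym (progression-depth hi c k)) (trans (suc-injective eq) (progression-depth hi c k′))))
  depth-into : MapsInto n f (suc (L / 3)) (λ _ → true) depth
  depth-into x 1≤x x≤n fx with window x 1≤x x≤n fx
  ... | (lo<x , _ , _) = s≤s z≤n , s≤s (/-monoˡ-≤ 3 (∸-monoʳ-≤ hi lo<x)) , refl
  count≤ : countTo n f ≤ suc (L / 3)
  count≤ = subst (countTo n f ≤_) (countTo-all (suc (L / 3)))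
    (countTo-inj n (suc (L / 3)) f (λ _ → true) depth depth-inj depth-into)

mirror-multiple : ∀ u x → x % 3 ≡ (u + u) % 3 → x ≤ u + u → ((u + u) ∸ x) % 3 ≡ 0
mirror-multiple u x same x≤2u with same-residue⇒progression (u + u) x (sym same) x≤2u
... | (k , 2u≡x+3k) = trans (cong (λ z → (z ∸ x) % 3) 2u≡x+3k)
                            (trans (cong (_% 3) (m+n∸m≡n x (3 * k))) (multiple-residue k))

module FullClass {g} (T : NumericalSemigroup) (G : HasGenus T g) {u} (U : IsU1 T u)
  (full : ∀ s → InSi T g (u % 3) s ⇔ InProgression u g s) where

  u∈T : mem T u ≡ true
  u∈T = proj₁ U

  u≢0 : u % 3 ≢ 0
  u≢0 = proj₁ (proj₂ U)

  1≤u : 1 ≤ u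
  1≤u = u₁-positive T u U

  progression-in-T : ∀ k → u + 3 * k ≤ 2 * g → mem T (u + 3 * k) ≡ true
  progression-in-T k le = proj₁ (proj₂ (proj₂
    (Equivalence.from (full (u + 3 * k)) ((k , refl) , ≤-trans 1≤u (m≤m+n u (3 * k)) , le))))

  class-gap<u : ∀ x → mem T x ≡ false → x % 3 ≡ u % 3 → x < u
  class-gap<u x x-gap same with u ≤? x
  ... | no  u≰x = ≰⇒> u≰x
  ... | yes u≤x with same-residue⇒progression x u same u≤x
  ...   | (k , x≡) = ⊥-elim (true≢false (subst (λ z → mem T z ≡ true) (sym x≡)
            (progression-in-T k (subst (_≤ 2 * g) x≡ (<⇒≤ (gap<2g T g G x x-gap))))) x-gap)

  -- A gap in the class of u + u lies below u + u, since (u + u) + 3k is the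
  -- sum of u and u + 3k ∈ T (or exceeds 2g).
  doubled-gap<2u : ∀ x → mem T x ≡ false → x % 3 ≡ (u + u) % 3 → x < u + u
  doubled-gap<2u x x-gap same with u + u ≤? x
  ... | no  2u≰x = ≰⇒> 2u≰x
  ... | yes 2u≤x with same-residue⇒progression x (u + u) same 2u≤x
  ...   | (k , x≡) = ⊥-elim (true≢false (subst (λ z → mem T z ≡ true) (sym (trans x≡ (+-assoc u u (3 * k)))) x∈T) x-gap)
    where
    x∈T : mem T (u + (u + 3 * k)) ≡ true
    x∈T with u + 3 * k ≤? 2 * g
    ... | yes le = closed T u (u + 3 * k) u∈T (progression-in-T k le)
    ... | no  gt = mem-from-2g T g G (u + (u + 3 * k)) (≤-trans (<⇒≤ (≰⇒> gt)) (m≤n+m (u + 3 * k) u))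

  nonmultipleGaps : ℕ → Bool
  nonmultipleGaps = gaps T ∩ ∁ residue 0

  nonmultipleGap⁻ : ∀ x → nonmultipleGaps x ≡ true → mem T x ≡ false × x % 3 ≢ 0
  nonmultipleGap⁻ x e with ∧-true⁻ e
  ... | (x-gap , x≢0) = not-true⁻ x-gap , λ x≡0 → true≢false (⇒residue x x≡0) (not-true⁻ x≢0)

  large-gap : ∀ x → nonmultipleGaps x ≡ true → u ≤ x →
    u < x × x < u + u × x % 3 ≡ (u + u) % 3
  large-gap x e u≤x = ≤∧≢⇒< u≤x (λ u≡x → x≢u (cong (_% 3) (sym u≡x))) , doubled-gap<2u x x-gap x-doubled , x-doubled
    where
    x-gap = proj₁ (nonmultipleGap⁻ x e)
    x≢u : x % 3 ≢ u % 3
    x≢u same = <⇒≱ (class-gap<u x x-gap same) u≤x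
    x-doubled = third-residue u x u≢0 (proj₂ (nonmultipleGap⁻ x e)) x≢u

  -- The mirror image (u + u) - y of a large non-multiple gap y is a multiple
  -- of 3, hence never a (non-multiple) gap below u.
  no-crossing : ∀ x y → nonmultipleGaps x ≡ true → nonmultipleGaps y ≡ true →
    ¬ (y < u) → x ≡ (u + u) ∸ y → ⊥
  no-crossing x y ex ey y≮u x≡ with large-gap y ey (≮⇒≥ y≮u)
  ... | (_ , y<2u , y-doubled) =
    proj₂ (nonmultipleGap⁻ x ex) (trans (cong (_% 3) x≡) (mirror-multiple u y y-doubled (<⇒≤ y<2u)))

  fold : ℕ → ℕ
  fold x with x <? u
  ... | yes _ = x
  ... | no  _ = (u + u) ∸ x

  fold-inj : InjectiveOn (2 * g) nonmultipleGaps fold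
  fold-inj x y _ _ _ _ ex ey eq with x <? u | y <? u
  ... | yes _   | yes _   = eq
  ... | yes _   | no  y≮u = ⊥-elim (no-crossing x y ex ey y≮u eq)
  ... | no  x≮u | yes _   = ⊥-elim (no-crossing y x ey ex x≮u (sym eq))
  ... | no  x≮u | no  y≮u = ∸-cancelˡ-≡ (<⇒≤ (proj₁ (proj₂ (large-gap x ex (≮⇒≥ x≮u)))))
                                        (<⇒≤ (proj₁ (proj₂ (large-gap y ey (≮⇒≥ y≮u))))) eq

  fold-into : MapsInto (2 * g) nonmultipleGaps (pred u) (λ _ → true) fold
  fold-into x 1≤x _ ex with x <? u
  ... | yes x<u = 1≤x , <⇒≤pred x<u , refl
  ... | no  x≮u with large-gap x ex (≮⇒≥ x≮u)
  ...   | (u<x , x<2u , _) = m<n⇒0<n∸m x<2u , reflected≤ , refl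
    where
    reflected≤ : (u + u) ∸ x ≤ pred u
    reflected≤ = begin
      (u + u) ∸ x         ≤⟨ ∸-monoʳ-≤ (u + u) (subst (_≤ x) (+-comm 1 u) u<x) ⟩
      (u + u) ∸ (u + 1)   ≡⟨ [m+n]∸[m+o]≡n∸o u u 1 ⟩
      u ∸ 1               ≡⟨ sym (pred[m∸n]≡m∸[1+n] u 0) ⟩
      pred u ∎
      where open ≤-Reasoning

  -- Part (1): the g gaps split into at most γ multiples of 3 and at most
  -- u - 1 others, so g < u + γ.
  u₁-lower-bound : ∀ γ → Hyperelliptic 3 γ T → suc g ≤ u + γ
  u₁-lower-bound γ H = begin
    suc g                                              ≡⟨ cong suc (sym (genus-count T g G)) ⟩
    suc (countTo (2 * g) (gaps T))                     ≡⟨ cong suc (countTo-split (2 * g) (gaps T) (residue 0)) ⟩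
    suc (countTo (2 * g) (gaps T ∩ residue 0) + countTo (2 * g) nonmultipleGaps)
                                                       ≤⟨ s≤s (+-mono-≤ multiples≤γ nonmultiples≤u-1) ⟩
    suc (γ + pred u)                                   ≡⟨ sym (+-suc γ (pred u)) ⟩
    γ + suc (pred u)                                   ≡⟨ cong (γ +_) (suc-pred u {{>-nonZero 1≤u}}) ⟩
    γ + u                                              ≡⟨ +-comm γ u ⟩
    u + γ ∎
    where
    open ≤-Reasoning
    multiples≤γ : countTo (2 * g) (gaps T ∩ residue 0) ≤ γ
    multiples≤γ = subst (_≤ γ) (countTo-∩-comm (2 * g) (residue 0) (gaps T)) (multipleGaps-bound T γ H (2 * g))
    nonmultiples≤u-1 : countTo (2 * g) nonmultipleGaps ≤ pred u
    nonmultiples≤u-1 = subst (countTo (2 * g) nonmultipleGaps ≤_) (countTo-all (pred u))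
      (countTo-inj (2 * g) (pred u) nonmultipleGaps (λ _ → true) fold fold-inj fold-into)

  -- Part (2), the T side: T_{(u)₃} contains u, u + 3, …, u + 3(a - 1)
  -- whenever these stay within [2g].
  class-size : ∀ a → 3 * a + u ≤ 2 * g + 3 → a ≤ cardSi T g (u % 3)
  class-size a fits = subst (_≤ cardSi T g (u % 3)) (countTo-all a)
    (countTo-inj a (2 * g) (λ _ → true) (mem T ∩ residue (u % 3)) term term-inj term-into)
    where
    term : ℕ → ℕ
    term j = u + 3 * pred j
    term-inj : InjectiveOn a (λ _ → true) term
    term-inj x y 1≤x _ 1≤y _ _ _ eq = begin
      x               ≡⟨ sym (suc-pred x {{>-nonZero 1≤x}}) ⟩
      suc (pred x)    ≡⟨ cong suc (*-cancelˡ-≡ (pred x) (pred y) 3 (+-cancelˡ-≡ u _ _ eq)) ⟩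
      suc (pred y)    ≡⟨ suc-pred y {{>-nonZero 1≤y}} ⟩
      y ∎
      where open ≡-Reasoning
    term-into : MapsInto a (λ _ → true) (2 * g) (mem T ∩ residue (u % 3)) term
    term-into j 1≤j j≤a _ = ≤-trans 1≤u (m≤m+n u _) , term≤2g ,
      ∧-true⁺ (progression-in-T (pred j) term≤2g) (⇒residue (term j) (progression-residue u (pred j)))
      where
      term≤2g : term j ≤ 2 * g
      term≤2g = +-cancelʳ-≤ 3 _ _ (begin
        u + 3 * pred j + 3     ≡⟨ shift u (pred j) ⟩
        3 * suc (pred j) + u   ≡⟨ cong (λ z → 3 * z + u) (suc-pred j {{>-nonZero 1≤j}}) ⟩
        3 * j + u              ≤⟨ +-monoˡ-≤ u (*-monoʳ-≤ 3 j≤a) ⟩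
        3 * a + u              ≤⟨ fits ⟩
        2 * g + 3 ∎)
        where
        open ≤-Reasoning
        shift : ∀ u p → u + 3 * p + 3 ≡ 3 * suc p + u
        shift = solve-∀

-- Linear combination of the four counting bounds on a = #S_{(v)₃}
-- (w₁ = 2g - v, w₂ = v - 1, w₁ + w₂ + 1 = 2g = 3q + ρ).
combine-bounds : ∀ a b c g γ q ρ w₁ w₂ →
  3 * a ≤ 3 + w₁ → 3 * a ≤ 3 * b + (3 + w₂) → a + b + c ≤ g → q ≤ c + γ →
  w₁ + w₂ + 1 ≡ 3 * q + ρ → 9 * a ≤ 3 * (g + γ) + 5 + ρ
combine-bounds a b c g γ q ρ w₁ w₂ h₁ h₂ h₃ h₄ hw = +-cancelʳ-≤ (3 * c) _ _ (begin
  9 * a + 3 * c                   ≤⟨ +-cancelʳ-≤ (3 * b) _ _ (begin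
     9 * a + 3 * c + 3 * b          ≡⟨ regroup₁ a b c ⟩
     3 * a + (3 * a + 3 * (a + b + c)) ≤⟨ +-mono-≤ h₁ (+-mono-≤ h₂ (*-monoʳ-≤ 3 h₃)) ⟩
     (3 + w₁) + ((3 * b + (3 + w₂)) + 3 * g) ≡⟨ regroup₂ b g w₁ w₂ ⟩
     3 * g + 5 + (w₁ + w₂ + 1) + 3 * b ∎) ⟩
  3 * g + 5 + (w₁ + w₂ + 1)       ≡⟨ cong (3 * g + 5 +_) hw ⟩
  3 * g + 5 + (3 * q + ρ)         ≤⟨ +-monoʳ-≤ (3 * g + 5) (+-monoˡ-≤ ρ (*-monoʳ-≤ 3 h₄)) ⟩
  3 * g + 5 + (3 * (c + γ) + ρ)   ≡⟨ regroup₃ c g γ ρ ⟩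
  3 * (g + γ) + 5 + ρ + 3 * c ∎)
  where
  open ≤-Reasoning
  regroup₁ : ∀ a b c → 9 * a + 3 * c + 3 * b ≡ 3 * a + (3 * a + 3 * (a + b + c))
  regroup₁ = solve-∀
  regroup₂ : ∀ b g w₁ w₂ → (3 + w₁) + ((3 * b + (3 + w₂)) + 3 * g) ≡ 3 * g + 5 + (w₁ + w₂ + 1) + 3 * b
  regroup₂ = solve-∀
  regroup₃ : ∀ c g γ ρ → 3 * g + 5 + (3 * (c + γ) + ρ) ≡ 3 * (g + γ) + 5 + ρ + 3 * c
  regroup₃ = solve-∀

≤ᵇ-true⁻ : ∀ {x y} → (x ≤ᵇ y) ≡ true → x ≤ y
≤ᵇ-true⁻ {x} {y} e = ≤ᵇ⇒≤ x y (subst T (sym e) tt)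

≤ᵇ-false⁻ : ∀ {x y} → (x ≤ᵇ y) ≡ false → y < x
≤ᵇ-false⁻ {x} {y} e = ≰⇒> (λ x≤y → subst T e (≤⇒≤ᵇ x≤y))

module ClassOfU₁ {γ g} (S : NumericalSemigroup) (H : Hyperelliptic 3 γ S) (G : HasGenus S g)
  {v} (V : IsU1 S v) (v≤2g : v ≤ 2 * g) where

  n = 2 * g

  classV classW class0 : ℕ → Bool
  classV = mem S ∩ residue (v % 3)
  classW = mem S ∩ residue ((v + v) % 3)
  class0 = mem S ∩ residue 0

  v≢0 : v % 3 ≢ 0
  v≢0 = proj₁ (proj₂ V)

  1≤v : 1 ≤ v
  1≤v = u₁-positive S v V

  classV⁻ : ∀ s → classV s ≡ true → mem S s ≡ true × s % 3 ≡ v % 3 × ∃[ k ] s ≡ v + 3 * k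
  classV⁻ s e with ∧-true⁻ e
  ... | (s∈S , s≡v) = s∈S , residue⇒ s s≡v , class-of-u₁ S v V s s∈S (residue⇒ s s≡v)

  classV-window : 3 * countTo n classV ≤ 3 + (n ∸ v)
  classV-window = subst (λ z → 3 * countTo n classV ≤ 3 + (n ∸ z)) (suc-pred v {{>-nonZero 1≤v}})
    (progression-window n (pred v) n v classV within)
    where
    within : Within n (λ x → classV x ≡ true → pred v < x × x ≤ n × ∃[ k ] x ≡ v + 3 * k)
    within x _ x≤n e with classV⁻ x e
    ... | (_ , _ , k , refl) = <-≤-trans (≤-reflexive (suc-pred v {{>-nonZero 1≤v}})) (m≤m+n v (3 * k)) , x≤n , k , refl

  -- Translation by v: s ↦ s + v maps S_{(v)₃} ∩ [2g - v] into S_{(v+v)₃}; the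
  -- remaining elements lie in the window (2g - v, 2g].
  fits : ℕ → Bool
  fits s = s + v ≤ᵇ n

  low-shift : countTo n (classV ∩ fits) ≤ countTo n classW
  low-shift = countTo-inj n n (classV ∩ fits) classW (_+ v)
    (λ x y _ _ _ _ _ _ eq → +-cancelʳ-≡ v x y eq) into
    where
    into : MapsInto n (classV ∩ fits) n classW (_+ v)
    into s 1≤s _ e with ∧-true⁻ e
    ... | (e-class , e-fits) with classV⁻ s e-class
    ...   | (s∈S , s≡v , _) = ≤-trans 1≤s (m≤m+n s v) , ≤ᵇ-true⁻ e-fits ,
              ∧-true⁺ (closed S s v s∈S (proj₁ V)) (⇒residue (s + v) (sum-residue s v s≡v))

  high-window : 3 * countTo n (classV ∩ ∁ fits) ≤ 3 + pred v
  high-window = subst (λ z → 3 * countTo n (classV ∩ ∁ fits) ≤ 3 + z) top-length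
    (progression-window n (n ∸ v) n v (classV ∩ ∁ fits) within)
    where
    top-length : n ∸ suc (n ∸ v) ≡ pred v
    top-length = trans (sym (pred[m∸n]≡m∸[1+n] n (n ∸ v))) (cong pred (m∸[m∸n]≡n v≤2g))
    within : Within n (λ x → (classV ∩ ∁ fits) x ≡ true → n ∸ v < x × x ≤ n × ∃[ k ] x ≡ v + 3 * k)
    within x 1≤x x≤n e with ∧-true⁻ e
    ... | (e-class , e-unfit) =
      m<n+o⇒m∸n<o n v {{>-nonZero 1≤x}} (subst (n <_) (+-comm x v) (≤ᵇ-false⁻ (not-true⁻ e-unfit))) ,
      x≤n , proj₂ (proj₂ (classV⁻ x e-class))

  classV-shift : 3 * countTo n classV ≤ 3 * countTo n classW + (3 + pred v)
  classV-shift = begin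
    3 * countTo n classV                                           ≡⟨ cong (3 *_) (countTo-split n classV fits) ⟩
    3 * (countTo n (classV ∩ fits) + countTo n (classV ∩ ∁ fits))  ≡⟨ *-distribˡ-+ 3 (countTo n (classV ∩ fits)) _ ⟩
    3 * countTo n (classV ∩ fits) + 3 * countTo n (classV ∩ ∁ fits) ≤⟨ +-mono-≤ (*-monoʳ-≤ 3 low-shift) high-window ⟩
    3 * countTo n classW + (3 + pred v) ∎
    where open ≤-Reasoning

  -- S_{(v)₃}, S_{(v+v)₃} and S_0 are disjoint parts of S ∩ [2g], which has
  -- exactly g elements.
  three-classes : countTo n classV + countTo n classW + countTo n class0 ≤ g
  three-classes = begin
    countTo n classV + countTo n classW + countTo n class0
      ≤⟨ +-monoˡ-≤ (countTo n class0) (+-mono-≤ (countTo-mono n classV (nonzero ∩ residue (v % 3)) V-inside)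
                                                 (countTo-mono n classW (nonzero ∩ ∁ residue (v % 3)) W-inside)) ⟩
    countTo n (nonzero ∩ residue (v % 3)) + countTo n (nonzero ∩ ∁ residue (v % 3)) + countTo n class0
      ≡⟨ cong (_+ countTo n class0) (sym (countTo-split n nonzero (residue (v % 3)))) ⟩
    countTo n nonzero + countTo n class0
      ≡⟨ +-comm (countTo n nonzero) (countTo n class0) ⟩
    countTo n class0 + countTo n nonzero
      ≡⟨ sym (countTo-split n (mem S) (residue 0)) ⟩
    countTo n (mem S)
      ≡⟨ element-count S g G ⟩
    g ∎
    where
    open ≤-Reasoning
    nonzero : ℕ → Bool
    nonzero = mem S ∩ ∁ residue 0
    V-inside : Within n (λ x → classV x ≡ true → (nonzero ∩ residue (v % 3)) x ≡ true)
    V-inside x _ _ e with ∧-true⁻ e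
    ... | (x∈S , x≡v) = ∧-true⁺ (∧-true⁺ x∈S (cong not (residue-false x (residue⇒ x x≡v) v≢0))) x≡v
    W-inside : Within n (λ x → classW x ≡ true → (nonzero ∩ ∁ residue (v % 3)) x ≡ true)
    W-inside x _ _ e with ∧-true⁻ e | doubled-residue v v≢0
    ... | (x∈S , x≡w) | (w≢0 , w≢v) =
      ∧-true⁺ (∧-true⁺ x∈S (cong not (residue-false x (residue⇒ x x≡w) w≢0)))
              (cong not (residue-false x (residue⇒ x x≡w) w≢v))

  -- The ⌊2g/3⌋ multiples of 3 in [2g] are elements of S_0 or among the at most
  -- γ multiple-of-3 gaps.
  multiples : n / 3 ≤ countTo n class0 + γ
  multiples = begin
    n / 3                                                       ≡⟨ sym (multiples-count n) ⟩
    countTo n (residue 0)                                       ≡⟨ countTo-split n (residue 0) (mem S) ⟩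
    countTo n (residue 0 ∩ mem S) + countTo n (multipleGaps S)  ≤⟨ +-mono-≤ (≤-reflexive (countTo-∩-comm n (residue 0) (mem S)))
                                                                             (multipleGaps-bound S γ H n) ⟩
    countTo n class0 + γ ∎
    where open ≤-Reasoning

  -- The windows of lengths 2g - v and v - 1 together cover [2g] but for one point.
  window-lengths : (n ∸ v) + pred v + 1 ≡ 3 * (n / 3) + n % 3
  window-lengths = begin
    (n ∸ v) + pred v + 1   ≡⟨ +-assoc (n ∸ v) (pred v) 1 ⟩
    (n ∸ v) + (pred v + 1) ≡⟨ cong ((n ∸ v) +_) (trans (+-comm (pred v) 1) (suc-pred v {{>-nonZero 1≤v}})) ⟩
    (n ∸ v) + v            ≡⟨ m∸n+n≡m v≤2g ⟩
    n                      ≡⟨ euclid n ⟩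
    3 * (n / 3) + n % 3 ∎
    where open ≡-Reasoning

  bound : 9 * countTo n classV ≤ 3 * (g + γ) + 5 + n % 3
  bound = combine-bounds (countTo n classV) (countTo n classW) (countTo n class0) g γ (n / 3) (n % 3) (n ∸ v) (pred v)
    classV-window classV-shift three-classes multiples window-lengths

class-of-u₁-bound : ∀ γ g S → Hyperelliptic 3 γ S → HasGenus S g → ∀ v → IsU1 S v →
  9 * cardSi S g (v % 3) ≤ 3 * (g + γ) + 5 + (2 * g) % 3
class-of-u₁-bound γ g S H G v V with v ≤? 2 * g
... | yes v≤2g = ClassOfU₁.bound S H G V v≤2g
... | no  v≰2g = ≤-trans (*-monoʳ-≤ 9 empty) z≤n
  where
  empty : cardSi S g (v % 3) ≤ 0
  empty = countTo-support (2 * g) 0 (mem S ∩ residue (v % 3)) (λ s _ s≤2g e →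
    ⊥-elim (v≰2g (≤-trans (v≤s s e) s≤2g)))
    where
    v≤s : ∀ s → (mem S ∩ residue (v % 3)) s ≡ true → v ≤ s
    v≤s s e with ∧-true⁻ e
    ... | (s∈S , s≡v) with class-of-u₁ S v V s s∈S (residue⇒ s s≡v)
    ...   | (k , refl) = m≤m+n v (3 * k)

thirds : ∀ a t → 9 * a ≤ 3 * t + 2 → 3 * a ≤ t
thirds a t le = triple-cancel (3 * a) t (subst (_≤ 3 * t + 2) (ninefold a) le)
  where
  ninefold : ∀ a → 9 * a ≡ 3 * (3 * a)
  ninefold = solve-∀

doubled-genus-divisible : ∀ m γ a → m % 3 ≡ 2 → 3 * a ≡ 2 + (m + γ + γ) → (2 * (m + γ)) % 3 ≡ 0
doubled-genus-divisible m γ a m≡2 3a≡ = trans (cong (_% 3) 2g≡) (multiple-residue (m / 3 + a))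
  where
  open ≡-Reasoning
  split : ∀ m γ → 2 * (m + γ) + 2 ≡ m + (2 + (m + γ + γ))
  split = solve-∀
  merge : ∀ q a → 3 * q + 2 + 3 * a ≡ 3 * (q + a) + 2
  merge = solve-∀
  2g≡ : 2 * (m + γ) ≡ 3 * (m / 3 + a)
  2g≡ = +-cancelʳ-≡ 2 _ _ (begin
    2 * (m + γ) + 2               ≡⟨ split m γ ⟩
    m + (2 + (m + γ + γ))         ≡⟨ cong₂ _+_ (trans (euclid m) (cong (3 * (m / 3) +_) m≡2)) (sym 3a≡) ⟩
    3 * (m / 3) + 2 + 3 * a       ≡⟨ merge (m / 3) a ⟩
    3 * (m / 3 + a) + 2 ∎)

-- The arithmetic of part (2), with g = m + γ and δ = ⌊(m)₃/2⌋. The counting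
-- bound 9a ≤ 3(g + γ) + 5 + (2g)₃ gives 3a ≤ g + γ + 2; when δ = 1, the value
-- 3a = g + γ + 2 would force 3 | 2g and hence the sharper 3a ≤ g + γ + 1.
-- Either way 3a + u ≤ 2g + 3 for u = m + 1 + δ.
optimal-u₁-arith : ∀ m γ a → 9 * a ≤ 3 * (m + γ + γ) + 5 + (2 * (m + γ)) % 3 →
  3 * a + (m + 1 + (m % 3) / 2) ≤ 2 * (m + γ) + 3
optimal-u₁-arith m γ a nine = begin
  3 * a + (m + 1 + δ)       ≡⟨ regroup (3 * a) m δ ⟩
  (δ + 3 * a) + (m + 1)     ≤⟨ +-monoˡ-≤ (m + 1) (δ-bound (residue-cases m)) ⟩
  (2 + Y) + (m + 1)         ≡⟨ total m γ ⟩
  2 * (m + γ) + 3 ∎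
  where
  open ≤-Reasoning
  Y = m + γ + γ
  δ = (m % 3) / 2
  ρ = (2 * (m + γ)) % 3
  regroup : ∀ x m δ → x + (m + 1 + δ) ≡ (δ + x) + (m + 1)
  regroup = solve-∀
  total : ∀ m γ → (2 + (m + γ + γ)) + (m + 1) ≡ 2 * (m + γ) + 3
  total = solve-∀
  plus-three : ∀ Y → 3 * Y + 5 + 3 ≡ 3 * (2 + Y) + 2
  plus-three = solve-∀
  plus-zero : ∀ Y → 3 * Y + 5 + 0 ≡ 3 * (1 + Y) + 2
  plus-zero = solve-∀
  loose : 3 * a ≤ 2 + Y
  loose = thirds a (2 + Y) (begin
    9 * a           ≤⟨ nine ⟩
    3 * Y + 5 + ρ   ≤⟨ +-monoʳ-≤ (3 * Y + 5) (m%n≤n (2 * (m + γ)) 3) ⟩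
    3 * Y + 5 + 3   ≡⟨ plus-three Y ⟩
    3 * (2 + Y) + 2 ∎)
  tight : ρ ≡ 0 → 3 * a ≤ 1 + Y
  tight ρ≡0 = thirds a (1 + Y) (begin
    9 * a           ≤⟨ nine ⟩
    3 * Y + 5 + ρ   ≡⟨ cong (3 * Y + 5 +_) ρ≡0 ⟩
    3 * Y + 5 + 0   ≡⟨ plus-zero Y ⟩
    3 * (1 + Y) + 2 ∎)
  δ-bound : m % 3 ≡ 0 ⊎ m % 3 ≡ 1 ⊎ m % 3 ≡ 2 → δ + 3 * a ≤ 2 + Y
  δ-bound (inj₁ m≡0)        rewrite m≡0 = loose
  δ-bound (inj₂ (inj₁ m≡1)) rewrite m≡1 = loose
  δ-bound (inj₂ (inj₂ m≡2)) rewrite m≡2 with ρ ≟ 0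
  ... | yes ρ≡0 = s≤s (tight ρ≡0)
  ... | no  ρ≢0 = ≤∧≢⇒< loose (λ 3a≡ → ρ≢0 (doubled-genus-divisible m γ a m≡2 3a≡))

optimal-u₁ : ∀ a g γ → γ ≤ g → 9 * a ≤ 3 * (g + γ) + 5 + (2 * g) % 3 →
  3 * a + ((g ∸ γ) + 1 + ((g ∸ γ) % 3) / 2) ≤ 2 * g + 3
optimal-u₁ a g γ γ≤g = subst
  (λ h → 9 * a ≤ 3 * (h + γ) + 5 + (2 * h) % 3 → 3 * a + ((g ∸ γ) + 1 + ((g ∸ γ) % 3) / 2) ≤ 2 * h + 3)
  (m∸n+n≡m γ≤g) (optimal-u₁-arith (g ∸ γ) γ a)

lemma2p6 : (γ : ℕ) → ∃[ g₀ ] ((g : ℕ) → g₀ ≤ g →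
    (T : NumericalSemigroup) → Hyperelliptic 3 γ T → HasGenus T g →
    (u₁ : ℕ) → IsU1 T u₁ →
    (∀ s → InSi T g (u₁ % 3) s ⇔ InProgression u₁ g s) →
    (suc g ≤ u₁ + γ)
    × (u₁ ≡ (g ∸ γ) + 1 + ((g ∸ γ) % 3) / 2 →
    (S : NumericalSemigroup) → Hyperelliptic 3 γ S → HasGenus S g →
    (v : ℕ) → IsU1 S v → cardSi S g (v % 3) ≤ cardSi T g (u₁ % 3)))
lemma2p6 γ = γ , λ g γ≤g T HT GT u U full →
  FullClass.u₁-lower-bound T GT U full γ HT ,
  λ u≡ S HS GS v V →
    FullClass.class-size T GT U full (cardSi S g (v % 3))
      (subst (λ w → 3 * cardSi S g (v % 3) + w ≤ 2 * g + 3) (sym u≡)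
        (optimal-u₁ (cardSi S g (v % 3)) g γ γ≤g (class-of-u₁-bound γ g S HS GS v V)))
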